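{- Let $G=(V,E)$ be a connected, undirected, unweighted graph, $R\subseteq V$ a set of landmarks and $H=(R,\delta_H)$ the highway. Let $L$ be a pruned landmark labelling over $G$ constructed using the landmarks in $R$ (in some order). Then $L$ (restricted to the labels of vertices in $V\setminus R$) satisfies the highway cover property over $(G,H)$.
   Context: $d_G(u,v)$ denotes the shortest-path distance in $G$. A vertex $x$ lies on a shortest path between $u$ and $w$ if $d_G(u,x)+d_G(x,w)=d_G(u,w)$. A highway is a pair $H=(R,\delta_H)$ with $\delta_H(r_1,r_2)=d_G(r_1,r_2)$ for all $r_1,r_2\in R$. A label $L(v)$ is a set of entries $(r,\delta_L(r,v))$ with $r\in R$ and $\delta_L(r,v)=d_G(r,v)$. For labels, $Q(s,t,L)=\min\{\delta_L(u,s)+\delta_L(u,t): (u,\delta_L(u,s))\in L(s),(u,\delta_L(u,t))\in L(t)\}$, and $Q(s,t,L)=\infty$ if $L(s),L(t)$ share no landmark. Pruned landmark labelling with order $r_1,\dots,r_k$ of $R$: start with $L(v)=\emptyset$ for all $v\in V$; for $i=1,\dots,k$ run a BFS from $r_i$ in which, when a vertex $u$ at BFS distance $d$ from $r_i$ is processed, if $Q(r_i,u,L)\le d$ (with $L$ the labels built by the previous BFSs) then $u$ is pruned (no entry added and its neighbours are not expanded from $u$), and otherwise $(r_i,d)$ is added to $L(u)$ and its unvisited neighbours are enqueued at distance $d+1$. $L$ satisfies the highway cover property over $(G,H)$ if for all $s,t\in V\setminus R$ and every $r\in R$ there exist $(r_i,\delta_L(r_i,s))\in L(s)$ and $(r_j,\delta_L(r_j,t))\in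 L(t)$ such that $r_i$ lies on a shortest path between $r$ and $s$ and $r_j$ lies on a shortest path between $r$ and $t$ (possibly $r_i=r$ or $r_j=r$). -}

module Defs where

open import Data.Nat using (ℕ; zero; suc; _+_; _≤ᵇ_; _⊓_)
open import Data.Fin using (Fin; _≟_)
open import Data.Bool using (Bool; true; false; _∧_; _∨_; not; if_then_else_)
open import Data.List using (List; []; _∷_; _++_; [_]; concatMap; foldr; foldl; allFin)
open import Data.Bool.ListAction using (any)
open import Data.Maybe using (Maybe; just; nothing)
open import Data.Product using (_×_; _,_; ∃)
open import Relation.Nullary using (does)
open import Relation.Binary.PropositionalEquality using (_≡_)

record Graph (n : ℕ) : Set where
  field
    adj    : Fin n → Fin n → Bool
    sym    : ∀ u v → adj u v ≡ adj v u
    irrefl : ∀ u → adj u u ≡ false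
open Graph public

data Walk {n} (G : Graph n) : Fin n → Fin n → ℕ → Set where
  here : ∀ {u} → Walk G u u zero
  step : ∀ {u v w k} → adj G u v ≡ true → Walk G v w k → Walk G u w (suc k)

Connected : ∀ {n} → Graph n → Set
Connected {n} G = ∀ (u v : Fin n) → ∃ λ k → Walk G u v k

IsShortestPathDistance : ∀ {n} → Graph n → (Fin n → Fin n → ℕ) → Set
IsShortestPathDistance {n} G d =
  ∀ (u v : Fin n) → Walk G u v (d u v) × (∀ k → Walk G u v k → d u v Data.Nat.≤ k)

OnShortestPath : ∀ {n} → (Fin n → Fin n → ℕ) → Fin n → Fin n → Fin n → Set
OnShortestPath d u x w = d u x + d x w ≡ d u w

-- A labelling: each vertex has a list of entries (landmark, distance).
Labels : ℕ → Set
Labels n = Fin n → List (Fin n × ℕ)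

emptyLabels : ∀ {n} → Labels n
emptyLabels _ = []

private
  minM : Maybe ℕ → Maybe ℕ → Maybe ℕ
  minM nothing  y        = y
  minM (just a) nothing  = just a
  minM (just a) (just b) = just (a ⊓ b)

-- Q(s,t,L); nothing encodes ∞ (no common landmark).
Q : ∀ {n} → Labels n → Fin n → Fin n → Maybe ℕ
Q L s t = foldr minM nothing
  (concatMap (λ { (u , a) → concatMap (λ { (w , b) →
       if does (u ≟ w) then [ just (a + b) ] else [] }) (L t) }) (L s))

prunes : ∀ {n} → Labels n → Fin n → Fin n → ℕ → Bool
prunes L r u d with Q L r u
... | just q  = q ≤ᵇ d
... | nothing = false

-- L0    : labels built by previous BFSs (used for the pruning test)
--   acc   : labels being extended by this BFS
--   k     : current BFS distance
--   vis   : vertices already visited (enqueued)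
--   front : vertices at BFS distance k (the current level of the queue)
-- A vertex of the current level that is not pruned receives (r,k) and its
-- unvisited neighbours form the next level (and become visited).
prunedBFSLoop : ∀ {n} → Graph n → Labels n → Fin n → ℕ → ℕ →
                (Fin n → Bool) → (Fin n → Bool) → Labels n → Labels n
prunedBFSLoop G L0 r zero     k vis front acc = acc
prunedBFSLoop {n} G L0 r (suc fuel) k vis front acc =
  prunedBFSLoop G L0 r fuel (suc k) vis' front' acc'
  where
    expanded : Fin n → Bool
    expanded u = front u ∧ not (prunes L0 r u k)
    acc' : Labels n
    acc' u = if expanded u then acc u ++ [ (r , k) ] else acc u
    front' : Fin n → Bool
    front' v = not (vis v) ∧ any (λ u → expanded u ∧ adj G u v) (allFin n)
    vis' : Fin n → Bool
    vis' v = vis v ∨ front' v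

-- Pruned BFS from r given the labels L of the previous BFSs.
-- n levels suffice (BFS distances are < n).
prunedBFS : ∀ {n} → Graph n → Labels n → Fin n → Labels n
prunedBFS {n} G L r =
  prunedBFSLoop G L r n zero (λ v → does (v ≟ r)) (λ v → does (v ≟ r)) L

pll : ∀ {n} → Graph n → List (Fin n) → Labels n
pll G rs = foldl (prunedBFS G) emptyLabels rs

-- Besides soundness (every entry (x , a) of L(v) names a
-- processed landmark x with d x v ≤ a) we maintain the invariant that the
-- labels contain a hub for every pair s, t joined by a shortest path through a
-- processed landmark w: a common landmark x stored in L(s) and L(t) with its
-- exact distances and lying on a shortest s–t path.  A single pruned BFS from
-- r labels each vertex v with (r , d r v) unless an earlier landmark lies on a
-- shortest r–v path (pruning at the true distance certifies such a landmark,
-- and such coverage propagates along BFS edges); from this dichotomy the hub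
-- invariant extends from P to P ∪ {r}.  Taking s := r and w := r for a
-- landmark r, the hub of (r, s) is the landmark required by the theorem.
module Submission where

open import Defs
open import Data.Nat using (ℕ; zero; suc; _+_; _∸_; _≤_; _<_; _⊓_)
open import Data.Nat.Properties hiding (_≟_)
import Data.Fin.Properties as Fin
open import Data.Fin using (Fin; _≟_; toℕ)
open import Data.Bool using (Bool; true; false; T; not; _∧_; _∨_; if_then_else_)
open import Data.Bool.Properties using (T-∧; T-∨; T-≡; T-not-≡)
open import Data.Bool.ListAction using (any)
open import Data.List using (List; []; _∷_; _++_; [_]; foldr; foldl; allFin)
open import Data.List.Membership.Propositional using (_∈_; _∉_; find; lose)
open import Data.List.Membership.Propositional.Properties
  using (∈-concatMap⁻; foldr-selective; ∈-++⁺ˡ; ∈-++⁺ʳ; ∈-++⁻; ∈-allFin)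
open import Data.List.Relation.Unary.Any using (here; there; satisfied)
open import Data.List.Relation.Unary.Any.Properties using (any⁺; any⁻)
open import Data.List.Relation.Unary.Unique.Propositional using (Unique)
open import Data.Maybe using (Maybe; just; nothing)
open import Data.Product using (_×_; _,_; ∃; ∃₂; proj₁; proj₂)
open import Data.Sum using (_⊎_; inj₁; inj₂)
import Data.Sum as Sum
open import Data.Empty using (⊥; ⊥-elim)
open import Data.Unit using (tt)
open import Algebra.Definitions using (Selective)
open import Function.Bundles using (Equivalence)
open import Relation.Nullary using (does; yes; no)
import Relation.Binary.PropositionalEquality as ≡
open ≡ using (_≡_; refl; cong; subst; trans)

module Distances {n} (G : Graph n) (d : Fin n → Fin n → ℕ)
                 (isd : IsShortestPathDistance G d) where

  _++ᵂ_ : ∀ {u v w k l} → Walk G u v k → Walk G v w l → Walk G u w (k + l)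
  here     ++ᵂ q = q
  step a p ++ᵂ q = step a (p ++ᵂ q)

  adj-sym : ∀ {u v} → adj G u v ≡ true → adj G v u ≡ true
  adj-sym {u} {v} a = trans (≡.sym (sym G u v)) a

  reverseᵂ : ∀ {u v k} → Walk G u v k → Walk G v u k
  reverseᵂ here       = here
  reverseᵂ (step a p) = subst (Walk G _ _) (+-comm _ 1) (reverseᵂ p ++ᵂ step (adj-sym a) here)

  splitᵂ : ∀ i {j u v} → Walk G u v (i + j) → ∃ λ x → Walk G u x i × Walk G x v j
  splitᵂ zero    p          = _ , here , p
  splitᵂ (suc i) (step a p) with splitᵂ i p
  ... | x , p₁ , p₂ = x , step a p₁ , p₂

  shortest : ∀ u v → Walk G u v (d u v)
  shortest u v = proj₁ (isd u v)

  minimal : ∀ {u v k} → Walk G u v k → d u v ≤ k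
  minimal {u} {v} {k} p = proj₂ (isd u v) k p

  d-sym : ∀ u v → d u v ≡ d v u
  d-sym u v = ≤-antisym (minimal (reverseᵂ (shortest v u))) (minimal (reverseᵂ (shortest u v)))

  d-triangle : ∀ u v w → d u w ≤ d u v + d v w
  d-triangle u v w = minimal (shortest u v ++ᵂ shortest v w)

  d-self : ∀ u → d u u ≡ 0
  d-self u = n≤0⇒n≡0 (minimal here)

  d≡0⇒≡ : ∀ {u v} → d u v ≡ 0 → u ≡ v
  d≡0⇒≡ {u} {v} e with subst (Walk G u v) e (shortest u v)
  ... | here = refl

  d-adj : ∀ {u v} → adj G u v ≡ true → d u v ≤ 1
  d-adj a = minimal (step a here)

  -- By the triangle inequality, the ≤ half of OnShortestPath suffices.
  onPath-≤ : ∀ s x t → d s x + d x t ≤ d s t → OnShortestPath d s x t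
  onPath-≤ s x t le = ≤-antisym le (d-triangle s x t)

  onPath-sym : ∀ {s x t} → OnShortestPath d s x t → OnShortestPath d t x s
  onPath-sym {s} {x} {t} e = begin
    d t x + d x s ≡⟨ ≡.cong₂ _+_ (d-sym t x) (d-sym x s) ⟩
    d x t + d s x ≡⟨ +-comm (d x t) (d s x) ⟩
    d s x + d x t ≡⟨ e ⟩
    d s t         ≡⟨ d-sym s t ⟩
    d t s         ∎
    where open ≡.≡-Reasoning

  onPath-prefix : ∀ {s x u v} → OnShortestPath d s x u → OnShortestPath d s u v →
                  OnShortestPath d s x v
  onPath-prefix {s} {x} {u} {v} xu uv = onPath-≤ s x v (begin
    d s x + d x v         ≤⟨ +-monoʳ-≤ (d s x) (d-triangle x u v) ⟩
    d s x + (d x u + d u v) ≡⟨ ≡.sym (+-assoc (d s x) (d x u) (d u v)) ⟩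
    d s x + d x u + d u v ≡⟨ cong (_+ d u v) xu ⟩
    d s u + d u v         ≡⟨ uv ⟩
    d s v                 ∎)
    where open ≤-Reasoning

  onPath-suffix : ∀ {s x u v} → OnShortestPath d u x v → OnShortestPath d s u v →
                  OnShortestPath d s x v
  onPath-suffix xv uv = onPath-sym (onPath-prefix (onPath-sym xv) (onPath-sym uv))

  predecessor : ∀ r v {k} → d r v ≡ suc k → ∃ λ u → adj G u v ≡ true × d r u ≡ k
  predecessor r v {k} e with subst (Walk G v r) (trans (d-sym v r) e) (shortest v r)
  ... | step {v = u} a p = u , adj-sym a , trans (d-sym r u) (≤-antisym (minimal p) lower)
    where
    lower : k ≤ d u r
    lower = ≤-pred (begin
      suc k         ≡⟨ ≡.sym (trans (d-sym v r) e) ⟩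
      d v r         ≤⟨ d-triangle v u r ⟩
      d v u + d u r ≤⟨ +-monoˡ-≤ (d u r) (d-adj a) ⟩
      suc (d u r)   ∎)
      where open ≤-Reasoning

  attained : ∀ r v {i} → i ≤ d r v → ∃ λ x → d r x ≡ i
  attained r v {i} i≤d with splitᵂ i (subst (Walk G r v) (≡.sym (m+[n∸m]≡n i≤d)) (shortest r v))
  ... | x , p₁ , p₂ = x , ≤-antisym (minimal p₁) (+-cancelʳ-≤ (d r v ∸ i) i (d r x) (begin
      i + (d r v ∸ i) ≡⟨ m+[n∸m]≡n i≤d ⟩
      d r v           ≤⟨ d-triangle r x v ⟩
      d r x + d x v   ≤⟨ +-monoʳ-≤ (d r x) (minimal p₂) ⟩
      d r x + (d r v ∸ i) ∎))
    where open ≤-Reasoning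

  -- Distances are smaller than the number of vertices: the distances
  -- 0,…,d r v are attained by pairwise distinct vertices.
  d<n : ∀ r v → d r v < n
  d<n r v = Fin.injective⇒≤ {f = vertexAt} injective
    where
    vertexAt : Fin (suc (d r v)) → Fin n
    vertexAt i = proj₁ (attained r v (Fin.toℕ≤pred[n] i))
    injective : ∀ {i j} → vertexAt i ≡ vertexAt j → i ≡ j
    injective {i} {j} e = Fin.toℕ-injective (begin
      toℕ i              ≡⟨ ≡.sym (proj₂ (attained r v (Fin.toℕ≤pred[n] i))) ⟩
      d r (vertexAt i)   ≡⟨ cong (d r) e ⟩
      d r (vertexAt j)   ≡⟨ proj₂ (attained r v (Fin.toℕ≤pred[n] j)) ⟩
      toℕ j              ∎)
      where open ≡.≡-Reasoning

min∞-selective : (m : Maybe ℕ → Maybe ℕ → Maybe ℕ) →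
  (∀ y → m nothing y ≡ y) → (∀ a → m (just a) nothing ≡ just a) →
  (∀ a b → m (just a) (just b) ≡ just (a ⊓ b)) → Selective _≡_ m
min∞-selective m m∞ₗ m∞ᵣ m⊓ nothing  y        = inj₂ (m∞ₗ y)
min∞-selective m m∞ₗ m∞ᵣ m⊓ (just a) nothing  = inj₁ (m∞ᵣ a)
min∞-selective m m∞ₗ m∞ᵣ m⊓ (just a) (just b) with ⊓-sel a b
... | inj₁ e = inj₁ (trans (m⊓ a b) (cong just e))
... | inj₂ e = inj₂ (trans (m⊓ a b) (cong just e))

fold-attained : ∀ {m : Maybe ℕ → Maybe ℕ → Maybe ℕ} → Selective _≡_ m →
  ∀ xs {q} → foldr m nothing xs ≡ just q → just q ∈ xs
fold-attained sel xs e with foldr-selective sel nothing xs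
... | inj₁ e∞  with () ← trans (≡.sym e∞) e
... | inj₂ mem = subst (_∈ xs) e mem

-- A finite query value is realised by a landmark common to both labels.
-- (The minimum used by Q is private to Defs; it meets the equations of
-- min∞-selective definitionally, whence the refl arguments.)
Q-witness : ∀ {n} (L : Labels n) s t {q} → Q L s t ≡ just q →
  ∃ λ x → ∃₂ λ a b → (x , a) ∈ L s × (x , b) ∈ L t × a + b ≡ q
Q-witness L s t e
  with (x , a) , xa∈Ls , q∈ ← find (∈-concatMap⁻ _ {xs = L s} (fold-attained
         (min∞-selective _ (λ _ → refl) (λ _ → refl) (λ _ _ → refl)) _ e))
  with (w , b) , wb∈Lt , q∈′ ← find (∈-concatMap⁻ _ {xs = L t} q∈)
  with x ≟ w | q∈′
... | yes refl | here refl = x , a , b , xa∈Ls , wb∈Lt , refl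

prunes-witness : ∀ {n} (L : Labels n) r u k → prunes L r u k ≡ true →
  ∃ λ x → ∃₂ λ a b → (x , a) ∈ L r × (x , b) ∈ L u × a + b ≤ k
prunes-witness L r u k e with Q L r u in eq
... | just q with x , a , b , xa∈Lr , xb∈Lu , a+b≡q ← Q-witness L r u eq =
  x , a , b , xa∈Lr , xb∈Lu , subst (_≤ k) (≡.sym a+b≡q) (≤ᵇ⇒≤ q k (Equivalence.from T-≡ e))

module Labelling {n} (G : Graph n) (d : Fin n → Fin n → ℕ)
                 (isd : IsShortestPathDistance G d) where
  open Distances G d isd

  Sound : (Fin n → Set) → Labels n → Set
  Sound P L = ∀ v x a → (x , a) ∈ L v → P x × d x v ≤ a

  module PrunedBFS (L₀ : Labels n) (r : Fin n) (P : Fin n → Set)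
                   (L₀-sound : Sound P L₀) where

    Covered : Fin n → Set
    Covered v = ∃ λ x → P x × OnShortestPath d r x v

    -- A vertex pruned at its true distance is covered: the certifying
    -- common landmark x satisfies d r x + d x v ≤ a + b ≤ d r v.
    pruned⇒covered : ∀ {v k} → k ≡ d r v → prunes L₀ r v k ≡ true → Covered v
    pruned⇒covered {v} {k} k≡d e
      with x , a , b , xa∈Lr , xb∈Lv , a+b≤k ← prunes-witness L₀ r v k e
      with px , dxr≤a ← L₀-sound r x a xa∈Lr
      with _ , dxv≤b ← L₀-sound v x b xb∈Lv =
      x , px , onPath-≤ r x v (begin
        d r x + d x v ≡⟨ cong (_+ d x v) (d-sym r x) ⟩
        d x r + d x v ≤⟨ +-mono-≤ dxr≤a dxv≤b ⟩
        a + b         ≤⟨ a+b≤k ⟩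
        k             ≡⟨ k≡d ⟩
        d r v         ∎)
      where open ≤-Reasoning

    covered-step : ∀ {u v} → adj G u v ≡ true → d r v ≡ suc (d r u) → Covered u → Covered v
    covered-step {u} {v} a e (x , px , xu) = x , px , onPath-prefix xu (onPath-≤ r u v (begin
      d r u + d u v ≤⟨ +-monoʳ-≤ (d r u) (d-adj a) ⟩
      d r u + 1     ≡⟨ +-comm (d r u) 1 ⟩
      suc (d r u)   ≡⟨ ≡.sym e ⟩
      d r v         ∎))
      where open ≤-Reasoning

    -- One level of the BFS: the state (k, vis, front, acc) is advanced
    -- exactly as in the body of prunedBFSLoop.
    module Level (k : ℕ) (vis front : Fin n → Bool) (acc : Labels n) where

      expands : Fin n → Bool
      expands u = front u ∧ not (prunes L₀ r u k)

      nextFront : Fin n → Bool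
      nextFront v = not (vis v) ∧ any (λ u → expands u ∧ adj G u v) (allFin n)

      nextVisited : Fin n → Bool
      nextVisited v = vis v ∨ nextFront v

      relabel : Labels n
      relabel u = if expands u then acc u ++ [ (r , k) ] else acc u

      expands⇒front : ∀ u → T (expands u) → T (front u)
      expands⇒front u eu = proj₁ (Equivalence.to T-∧ eu)

      expands-or-covered : ∀ u → T (front u) → d r u ≡ k → T (expands u) ⊎ Covered u
      expands-or-covered u fu du with prunes L₀ r u k in e
      ... | false = inj₁ (Equivalence.from T-∧ (fu , tt))
      ... | true  = inj₂ (pruned⇒covered (≡.sym du) e)

      nextFront-source : ∀ v → T (nextFront v) → ∃ λ u → T (expands u) × adj G u v ≡ true
      nextFront-source v tv
        with u , eu∧a ← satisfied (any⁻ _ (allFin n) (proj₂ (Equivalence.to T-∧ tv)))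
        with eu , a ← Equivalence.to T-∧ eu∧a = u , eu , Equivalence.to T-≡ a

      nextFront-intro : ∀ u v → vis v ≡ false → T (expands u) → adj G u v ≡ true → T (nextFront v)
      nextFront-intro u v nv eu a = Equivalence.from T-∧ (Equivalence.from T-not-≡ nv ,
        any⁺ _ (lose (∈-allFin u) (Equivalence.from T-∧ (eu , Equivalence.from T-≡ a))))

      relabel-keeps : ∀ u {e} → e ∈ acc u → e ∈ relabel u
      relabel-keeps u m with expands u
      ... | true  = ∈-++⁺ˡ m
      ... | false = m

      relabel-adds : ∀ u → T (expands u) → (r , k) ∈ relabel u
      relabel-adds u eu with expands u
      ... | true = ∈-++⁺ʳ (acc u) (here refl)

      relabel-sound : ∀ u {e} → e ∈ relabel u → e ∈ acc u ⊎ (T (expands u) × e ≡ (r , k))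
      relabel-sound u m with expands u
      ... | false = inj₁ m
      ... | true with ∈-++⁻ (acc u) m
      ...   | inj₁ m′         = inj₁ m′
      ...   | inj₂ (here e≡rk) = inj₂ (tt , e≡rk)

    record Invariant (k : ℕ) (vis front : Fin n → Bool) (acc : Labels n) : Set where
      field
        frontier-dist     : ∀ v → T (front v) → d r v ≤ k
        visited-dist      : ∀ v → T (vis v) → d r v ≤ k
        settled           : ∀ v → d r v < k → (r , d r v) ∈ acc v ⊎ Covered v
        frontier-complete : ∀ v → d r v ≡ k → T (front v) ⊎ Covered v
        entries-sound     : ∀ v x a → (x , a) ∈ acc v → (x , a) ∈ L₀ v ⊎ (x ≡ r × d r v ≤ a)
        entries-kept      : ∀ v {e} → e ∈ L₀ v → e ∈ acc v

    initial : Invariant 0 (λ v → does (v ≟ r)) (λ v → does (v ≟ r)) L₀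
    initial = record
      { frontier-dist     = atSource
      ; visited-dist      = atSource
      ; settled           = λ v ()
      ; frontier-complete = λ v e → inj₁ (source v (d≡0⇒≡ e))
      ; entries-sound     = λ v x a m → inj₁ m
      ; entries-kept      = λ v m → m
      }
      where
      atSource : ∀ v → T (does (v ≟ r)) → d r v ≤ 0
      atSource v t with v ≟ r
      ... | yes refl = ≤-reflexive (d-self r)
      source : ∀ v → r ≡ v → T (does (v ≟ r))
      source v refl with v ≟ v
      ... | yes _  = tt
      ... | no v≢v = ⊥-elim (v≢v refl)

    module Step {k vis front acc} (I : Invariant k vis front acc) where
      open Invariant I
      open Level k vis front acc

      frontier-dist′ : ∀ v → T (nextFront v) → d r v ≤ suc k
      frontier-dist′ v tv with u , eu , a ← nextFront-source v tv = begin
        d r v         ≤⟨ d-triangle r u v ⟩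
        d r u + d u v ≤⟨ +-mono-≤ (frontier-dist u (expands⇒front u eu)) (d-adj a) ⟩
        k + 1         ≡⟨ +-comm k 1 ⟩
        suc k         ∎
        where open ≤-Reasoning

      visited-dist′ : ∀ v → T (nextVisited v) → d r v ≤ suc k
      visited-dist′ v tv =
        Sum.[ (λ tv → m≤n⇒m≤1+n (visited-dist v tv)) , frontier-dist′ v ] (Equivalence.to T-∨ tv)

      settled′ : ∀ v → d r v < suc k → (r , d r v) ∈ relabel v ⊎ Covered v
      settled′ v lt with m<1+n⇒m<n∨m≡n lt
      ... | inj₁ lt′ = Sum.map₁ (relabel-keeps v) (settled v lt′)
      ... | inj₂ refl with frontier-complete v refl
      ...   | inj₂ c  = inj₂ c
      ...   | inj₁ fv = Sum.map₁ (relabel-adds v) (expands-or-covered v fv refl)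

      -- Visited vertices are within distance k, so those at k+1 are unvisited.
      unvisited : ∀ v → d r v ≡ suc k → vis v ≡ false
      unvisited v e with vis v in ev
      ... | false = refl
      ... | true  = ⊥-elim (1+n≰n (≤-trans (≤-reflexive (≡.sym e))
                                     (visited-dist v (Equivalence.from T-≡ ev))))

      -- A vertex at distance k+1 has a neighbour u at distance k; if u
      -- expands then v enters the next frontier, otherwise u is covered.
      frontier-complete′ : ∀ v → d r v ≡ suc k → T (nextFront v) ⊎ Covered v
      frontier-complete′ v e
        with u , a , du ← predecessor r v e
        with frontier-complete u du
      ... | inj₂ c  = inj₂ (covered-step a (trans e (cong suc (≡.sym du))) c)
      ... | inj₁ fu with expands-or-covered u fu du
      ...   | inj₁ eu = inj₁ (nextFront-intro u v (unvisited v e) eu a)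
      ...   | inj₂ c  = inj₂ (covered-step a (trans e (cong suc (≡.sym du))) c)

      entries-sound′ : ∀ v x a → (x , a) ∈ relabel v → (x , a) ∈ L₀ v ⊎ (x ≡ r × d r v ≤ a)
      entries-sound′ v x a m with relabel-sound v m
      ... | inj₁ m′         = entries-sound v x a m′
      ... | inj₂ (ev , refl) = inj₂ (refl , frontier-dist v (expands⇒front v ev))

      next : Invariant (suc k) nextVisited nextFront relabel
      next = record
        { frontier-dist     = frontier-dist′
        ; visited-dist      = visited-dist′
        ; settled           = settled′
        ; frontier-complete = frontier-complete′
        ; entries-sound     = entries-sound′
        ; entries-kept      = λ v m → relabel-keeps v (entries-kept v m)
        }

    loop : ∀ fuel {k vis front acc} → Invariant k vis front acc →
           ∃₂ λ vis′ front′ → Invariant (fuel + k) vis′ front′ (prunedBFSLoop G L₀ r fuel k vis front acc)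
    loop zero    {vis = vis} {front} I = vis , front , I
    loop (suc fuel) {k} {vis} {front} {acc} I with vis′ , front′ , I′ ← loop fuel (Step.next I) =
      vis′ , front′ , subst (λ j → Invariant j vis′ front′ result) (+-suc fuel k) I′
      where result = prunedBFSLoop G L₀ r (suc fuel) k vis front acc

    -- After n levels every vertex is settled, since d r v < n.
    done : ∃₂ λ vis front → Invariant n vis front (prunedBFS G L₀ r)
    done with vis , front , I ← loop n initial =
      vis , front , subst (λ j → Invariant j vis front (prunedBFS G L₀ r)) (+-identityʳ n) I

    labelled-or-covered : ∀ v → (r , d r v) ∈ prunedBFS G L₀ r v ⊎ Covered v
    labelled-or-covered v = Invariant.settled (proj₂ (proj₂ done)) v (d<n r v)

    new-entries : ∀ v x a → (x , a) ∈ prunedBFS G L₀ r v → (x , a) ∈ L₀ v ⊎ (x ≡ r × d r v ≤ a)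
    new-entries = Invariant.entries-sound (proj₂ (proj₂ done))

    kept-entries : ∀ v {e} → e ∈ L₀ v → e ∈ prunedBFS G L₀ r v
    kept-entries = Invariant.entries-kept (proj₂ (proj₂ done))

  Hub : Labels n → Fin n → Fin n → Fin n → Set
  Hub L s t x = (x , d x s) ∈ L s × (x , d x t) ∈ L t × OnShortestPath d s x t

  record Covers (P : Fin n → Set) (L : Labels n) : Set where
    field
      sound : Sound P L
      hubs  : ∀ s t w → P w → OnShortestPath d s w t → ∃ (Hub L s t)

  covers-resp : ∀ {P P′ L} → (∀ x → P x → P′ x) → (∀ x → P′ x → P x) → Covers P L → Covers P′ L
  covers-resp to from C = record
    { sound = λ v x a m → let px , dxv≤a = Covers.sound C v x a m in to x px , dxv≤a
    ; hubs  = λ s t w pw → Covers.hubs C s t w (from w pw)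
    }

  -- For a shortest s–t path through r: if s (or t) is covered by an older
  -- landmark y, then y lies on a shortest s–t path and the old hub survives;
  -- otherwise both s and t receive the entry for r, which is then a hub.
  bfs-covers : ∀ {P L} r → Covers P L → Covers (λ x → P x ⊎ x ≡ r) (prunedBFS G L r)
  bfs-covers {P} {L} r C = record { sound = sound′ ; hubs = hubs′ }
    where
    open Covers C
    open PrunedBFS L r P sound

    keep : ∀ {s t} → ∃ (Hub L s t) → ∃ (Hub (prunedBFS G L r) s t)
    keep (x , xs , xt , on) = x , kept-entries _ xs , kept-entries _ xt , on

    sound′ : Sound (λ x → P x ⊎ x ≡ r) (prunedBFS G L r)
    sound′ v x a m with new-entries v x a m
    ... | inj₁ m₀ = let px , dxv≤a = sound v x a m₀ in inj₁ px , dxv≤a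
    ... | inj₂ (refl , drv≤a) = inj₂ refl , drv≤a

    through-r : ∀ s t → OnShortestPath d s r t → ∃ (Hub (prunedBFS G L r) s t)
    through-r s t srt with labelled-or-covered s | labelled-or-covered t
    ... | inj₂ (y , py , rys) | _ = keep (hubs s t y py (onPath-prefix (onPath-sym rys) srt))
    ... | inj₁ _ | inj₂ (z , pz , rzt) = keep (hubs s t z pz (onPath-suffix rzt srt))
    ... | inj₁ rs | inj₁ rt = r , rs , rt , srt

    hubs′ : ∀ s t w → P w ⊎ w ≡ r → OnShortestPath d s w t → ∃ (Hub (prunedBFS G L r) s t)
    hubs′ s t w (inj₁ pw)   on  = keep (hubs s t w pw on)
    hubs′ s t w (inj₂ refl) srt = through-r s t srt

  fold-covers : ∀ {P L} rs → Covers P L →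
                Covers (λ x → P x ⊎ x ∈ rs) (foldl (prunedBFS G) L rs)
  fold-covers [] C = covers-resp (λ _ → inj₁) (λ { _ (inj₁ p) → p }) C
  fold-covers (r ∷ rs) C = covers-resp
    (λ { _ (inj₁ (inj₁ p)) → inj₁ p ; _ (inj₁ (inj₂ refl)) → inj₂ (here refl) ; _ (inj₂ m) → inj₂ (there m) })
    (λ { _ (inj₁ p) → inj₁ (inj₁ p) ; _ (inj₂ (here refl)) → inj₁ (inj₂ refl) ; _ (inj₂ (there m)) → inj₂ m })
    (fold-covers rs (bfs-covers r C))

  pll-covers : ∀ rs → Covers (λ x → ⊥ ⊎ x ∈ rs) (pll G rs)
  pll-covers rs = fold-covers rs (record { sound = λ _ _ _ () ; hubs = λ _ _ _ () })

  -- The highway cover property for one landmark: a hub of the pair (r, s),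
  -- which exists because r itself lies on every shortest r–s path, is a
  -- landmark recorded in L(s) with its exact distance, on a shortest r–s path.
  highway-cover : ∀ rs s r → r ∈ rs →
    ∃ λ ri → ri ∈ rs × (ri , d ri s) ∈ pll G rs s × OnShortestPath d r ri s
  highway-cover rs s r r∈rs
    with x , _ , xs , on ← Covers.hubs (pll-covers rs) r s r (inj₂ r∈rs) (cong (_+ d r s) (d-self r))
    with inj₂ x∈rs , _ ← Covers.sound (pll-covers rs) s x (d x s) xs = x , x∈rs , xs , on

-- Lemma 3.13.
lemma3p13 : ∀ {n} (G : Graph n) → Connected G →
    (d : Fin n → Fin n → ℕ) → IsShortestPathDistance G d →
    (rs : List (Fin n)) → Unique rs →
    ∀ (s t : Fin n) → s ∉ rs → t ∉ rs → ∀ (r : Fin n) → r ∈ rs →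
      (∃ λ ri → ri ∈ rs × (ri , d ri s) ∈ pll G rs s × OnShortestPath d r ri s) ×
      (∃ λ rj → rj ∈ rs × (rj , d rj t) ∈ pll G rs t × OnShortestPath d r rj t)
lemma3p13 G _ d isd rs _ s t _ _ r r∈rs = highway-cover rs s r r∈rs , highway-cover rs t r r∈rs
  where open Labelling G d isd
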